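{- For integers $k$ and $t$ with $k\geq 2$ and $0\leq t\leq k$, $$gr_k(K_3:tP_5,(k-t)P_3)\leq t+4.$$ That is, for every $n\geq t+4$, every edge-coloring of $K_n$ with colors $1,\dots,k$ that contains no rainbow triangle contains either a path $P_5$ all of whose edges have color $j$ for some $j\in\{1,\dots,t\}$, or a path $P_3$ all of whose edges have color $j$ for some $j\in\{t+1,\dots,k\}$.
   Context: $P_m$ denotes the path on $m$ vertices. A rainbow triangle is a triangle whose three edges receive three distinct colors. For graphs $G,H_1,\dots,H_k$, $gr_k(G:H_1,\dots,H_k)$ is the minimum integer $N$ such that every coloring of $K_n$, $n\geq N$, using colors $1,\dots,k$ contains either a rainbow copy of $G$ or, for some $i$, a copy of $H_i$ all of whose edges have color $i$. The notation $gr_k(G:tH,(k-t)K)$ means $gr_k(G:H_1,\dots,H_k)$ with $H_1=\dots=H_t=H$ and $H_{t+1}=\dots=H_k=K$. -}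

module Defs where

open import Data.Nat using (ℕ; suc; _<_; _≥_)
open import Data.Fin using (Fin; toℕ; inject₁) renaming (suc to fsuc)
open import Data.Product using (Σ; _×_; ∃-syntax)
open import Data.Sum using (_⊎_)
open import Function.Definitions using (Injective)
open import Relation.Binary.PropositionalEquality using (_≡_; _≢_)
open import Relation.Nullary using (¬_)

-- A k-edge-colouring of K_n: a symmetric function on pairs of vertices
-- (values on the diagonal are irrelevant). Colours are Fin k;
-- colour i in Fin k corresponds to colour (toℕ i + 1) in the paper.
record Colouring (n k : ℕ) : Set where
  field
    col : Fin n → Fin n → Fin k
    sym : ∀ x y → col x y ≡ col y x
open Colouring public

RainbowTriangle : ∀ {n k} → Colouring n k → Set
RainbowTriangle {n} c = ∃[ x ] ∃[ y ] ∃[ z ]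
  (x ≢ y × y ≢ z × x ≢ z ×
   col c x y ≢ col c y z × col c y z ≢ col c x z × col c x y ≢ col c x z)

-- a path P_(suc p) (suc p vertices, p edges) all of whose edges have colour i:
-- an injective sequence of suc p vertices, consecutive ones joined by colour i
MonoPath : ∀ {n k} → Colouring n k → (p : ℕ) → Fin k → Set
MonoPath {n} c p i = Σ (Fin (suc p) → Fin n) λ v →
  Injective _≡_ _≡_ v × (∀ (j : Fin p) → col c (v (inject₁ j)) (v (fsuc j)) ≡ i)

-- In a Gallai colouring of K_n (no rainbow triangle) with n ≥ 5 and no monochromatic P_5,
-- some vertex v is a monochromatic star: all edges at v have one colour q. This is proved by
-- induction on n, the base case K_5 being a direct analysis starting from a triangle with
-- two equally coloured edges. The theorem then follows by induction on the number of
-- colours allowed to contain a P_3: if q is such a colour, every q-coloured P_3 avoiding v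
-- extends through v to a q-coloured P_5, so deleting v leaves a colouring on one vertex fewer
-- in which q contains no P_3 either.
module Submission where

open import Defs hiding (sym)
open import Data.Nat using (ℕ; zero; suc; _≤_; _<_; _≥_; _+_; s≤s; s≤s⁻¹)
open import Data.Nat.Properties using (m≤m+n; ≤-trans; ≮⇒≥; +-comm)
open import Data.Fin using (Fin; toℕ; punchIn; inject₁; inject≤; fromℕ<; #_)
  renaming (zero to fzero; suc to fsuc)
open import Data.Fin.Properties
  using (_≟_; any?; all?; ¬∀⟶∃¬; <⇒notInjective; punchInᵢ≢i; punchIn-injective;
         suc-injective; inject₁-injective; toℕ-inject≤; toℕ-fromℕ<; toℕ-injective; toℕ<n)
import Data.Vec.Functional as V
open import Data.List using (List; []; _∷_; length; filter; tabulate)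
open import Data.List.Properties using (filter-notAll; length-tabulate)
open import Data.List.Relation.Unary.All using (All; []; _∷_)
import Data.List.Relation.Unary.All as All
import Data.List.Relation.Unary.Any as Any
open import Data.List.Relation.Unary.Any using (here; there)
open import Data.List.Membership.Propositional using (_∈_; _∉_)
open import Data.List.Membership.Propositional.Properties
  using (∈-filter⁺; ∈-filter⁻; ∈-tabulate⁺; ∈-tabulate⁻)
open import Data.Product using (∃-syntax; _×_; _,_; proj₁; proj₂; map₁; map₂)
open import Data.Sum using (_⊎_; inj₁; inj₂)
import Data.Sum as Sum
open import Data.Empty using (⊥-elim)
open import Function using (_∘_)
open import Function.Definitions using (Injective)
open import Relation.Nullary using (¬_; Dec; yes; no; contradiction)
open import Relation.Nullary.Decidable using (¬?; _×-dec_; decidable-stable; from-yes)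
open import Relation.Binary.Definitions using (Decidable)
open import Relation.Binary.PropositionalEquality
  using (_≡_; _≢_; refl; trans; cong; subst; ≢-sym) renaming (sym to ≡-sym)

Gallai : ∀ {n k} → Colouring n k → Set
Gallai c = ¬ RainbowTriangle c

restrict : ∀ {m n k} → (Fin m → Fin n) → Colouring n k → Colouring m k
restrict f c = record
  { col = λ x y → col c (f x) (f y)
  ; sym = λ x y → Colouring.sym c (f x) (f y)
  }

module _ {m n k} {f : Fin m → Fin n} (f-injective : Injective _≡_ _≡_ f) {c : Colouring n k} where

  restrict-gallai : Gallai c → Gallai (restrict f c)
  restrict-gallai gallai (x , y , z , x≢y , y≢z , x≢z , rainbow) =
    gallai (f x , f y , f z , x≢y ∘ f-injective , y≢z ∘ f-injective , x≢z ∘ f-injective , rainbow)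

  restrict-monoPath : ∀ {p i} → MonoPath (restrict f c) p i → MonoPath c p i
  restrict-monoPath (v , v-injective , edges) = f ∘ v , v-injective ∘ f-injective , edges

infix 4 _≢?_
_≢?_ : ∀ {n} → Decidable (_≢_ {A = Fin n})
i ≢? j = ¬? (i ≟ j)

fresh : ∀ {m n} (v : Fin m → Fin n) → m < n → ∃[ w ] (∀ j → w ≢ v j)
fresh {m} {n} v m<n with any? (λ w → all? (λ j → w ≢? v j))
... | yes found = found
... | no none = ⊥-elim (<⇒notInjective m<n index-injective)
  where
  hit : ∀ w → ∃[ j ] (w ≡ v j)
  hit w = map₂ (λ {j} → decidable-stable (w ≟ v j))
               (¬∀⟶∃¬ m _ (λ j → w ≢? v j) (λ w∉v → none (w , w∉v)))
  index-injective : Injective _≡_ _≡_ (proj₁ ∘ hit)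
  index-injective {w} {w′} e = trans (proj₂ (hit w)) (trans (cong v e) (≡-sym (proj₂ (hit w′))))

Covers : ∀ {n} → List (Fin n) → Set
Covers xs = ∀ w → w ∈ xs

covers? : ∀ {n} (xs : List (Fin n)) → Dec (Covers xs)
covers? xs = all? (λ w → Any.any? (w ≟_) xs)

covered : ∀ {n} {xs : List (Fin n)} (P : Fin n → Set) → Covers xs → All P xs → ∀ w → P w
covered P cover ps w = All.lookup ps (cover w)

module Paths {n k} {c : Colouring n k} {i : Fin k} where

  point : Fin n → MonoPath c 0 i
  point x = (λ _ → x) , (λ { {fzero} {fzero} _ → refl }) , λ ()

  MonoPath-cons : ∀ {p} x (P : MonoPath c p i) →
    (∀ j → x ≢ proj₁ P j) → col c x (proj₁ P fzero) ≡ i → MonoPath c (suc p) i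
  MonoPath-cons x (v , v-injective , edges) x∉v x-v₀ = x V.∷ v , injective , edges′
    where
    injective : Injective _≡_ _≡_ (x V.∷ v)
    injective {fzero}  {fzero}  _ = refl
    injective {fzero}  {fsuc b} e = contradiction e (x∉v b)
    injective {fsuc a} {fzero}  e = contradiction (≡-sym e) (x∉v a)
    injective {fsuc a} {fsuc b} e = cong fsuc (v-injective e)
    edges′ : ∀ j → col c ((x V.∷ v) (inject₁ j)) ((x V.∷ v) (fsuc j)) ≡ i
    edges′ fzero    = x-v₀
    edges′ (fsuc j) = edges j

  MonoPath-init : ∀ {p} → MonoPath c (suc p) i → MonoPath c p i
  MonoPath-init (v , v-injective , edges) =
    v ∘ inject₁ , inject₁-injective ∘ v-injective , edges ∘ inject₁

  path3 : ∀ {a b d} → a ≢ b → a ≢ d → b ≢ d → col c a b ≡ i → col c b d ≡ i → MonoPath c 2 i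
  path3 {a} {b} {d} a≢b a≢d b≢d ab bd =
    MonoPath-cons a (MonoPath-cons b (point d) (λ { fzero → b≢d }) bd)
      (λ { fzero → a≢b ; (fsuc fzero) → a≢d }) ab

  path5 : ∀ {a b d e f} →
    a ≢ b → a ≢ d → a ≢ e → a ≢ f → b ≢ d → b ≢ e → b ≢ f → d ≢ e → d ≢ f → e ≢ f →
    col c a b ≡ i → col c b d ≡ i → col c d e ≡ i → col c e f ≡ i → MonoPath c 4 i
  path5 {a} {b} {d} {e} {f} a≢b a≢d a≢e a≢f b≢d b≢e b≢f d≢e d≢f e≢f ab bd de ef =
    MonoPath-cons a (MonoPath-cons b (MonoPath-cons d (MonoPath-cons e (point f)
      (λ { fzero → e≢f }) ef)
      (λ { fzero → d≢e ; (fsuc fzero) → d≢f }) de)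
      (λ { fzero → b≢d ; (fsuc fzero) → b≢e ; (fsuc (fsuc fzero)) → b≢f }) bd)
      (λ { fzero → a≢b ; (fsuc fzero) → a≢d ; (fsuc (fsuc fzero)) → a≢e
         ; (fsuc (fsuc (fsuc fzero))) → a≢f }) ab

module Triangles {n k} {c : Colouring n k} (gallai : Gallai c) where

  private
    C : Fin n → Fin n → Fin k
    C = col c

  nonRainbow : ∀ {x y z} → x ≢ y → y ≢ z → x ≢ z → C x y ≢ C y z → C y z ≢ C x z → C x y ≡ C x z
  nonRainbow {x} {y} {z} x≢y y≢z x≢z xy≢yz yz≢xz = decidable-stable (C x y ≟ C x z)
    λ xy≢xz → gallai (x , y , z , x≢y , y≢z , x≢z , xy≢yz , yz≢xz , xy≢xz)

  equalLegs : ∀ {x y z q} → x ≢ y → x ≢ z → y ≢ z →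
    C y z ≡ q → C x y ≢ q → C x z ≢ q → C x y ≡ C x z
  equalLegs x≢y x≢z y≢z yz xy≢q xz≢q =
    nonRainbow x≢y y≢z x≢z (λ e → xy≢q (trans e yz)) (λ e → xz≢q (trans (≡-sym e) yz))

  legColour : ∀ {x y z q j} → x ≢ y → x ≢ z → y ≢ z →
    C y z ≡ q → C x y ≡ j → j ≢ q → C x z ≡ q ⊎ C x z ≡ j
  legColour {x} {y} {z} {q} x≢y x≢z y≢z yz xy j≢q with C x z ≟ q
  ... | yes xz = inj₁ xz
  ... | no xz≢q =
    inj₂ (trans (≡-sym (equalLegs x≢y x≢z y≢z yz (λ e → j≢q (trans (≡-sym xy) e)) xz≢q)) xy)

  monoCorner : ∀ {x y z} → x ≢ y → y ≢ z → x ≢ z →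
    C y x ≡ C y z ⊎ C x y ≡ C x z ⊎ C z x ≡ C z y
  monoCorner {x} {y} {z} x≢y y≢z x≢z with C x y ≟ C y z | C y z ≟ C x z
  ... | yes e | _ = inj₁ (trans (Colouring.sym c y x) e)
  ... | no _ | yes e =
    inj₂ (inj₂ (trans (Colouring.sym c z x) (trans (≡-sym e) (Colouring.sym c y z))))
  ... | no xy≢yz | no yz≢xz = inj₂ (inj₁ (nonRainbow x≢y y≢z x≢z xy≢yz yz≢xz))

MonoStar : ∀ {n k} → Colouring n k → Fin n → Fin k → Set
MonoStar c v q = ∀ w → w ≢ v → col c v w ≡ q

MonoStarOff : ∀ {n k} → Colouring n k → Fin n → Fin n → Fin k → Set
MonoStarOff c x v q = ∀ w → w ≢ x → w ≢ v → col c v w ≡ q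

MonoP5 : ∀ {n k} → Colouring n k → Set
MonoP5 c = ∃[ i ] MonoPath c 4 i

P5OrStar : ∀ {n k} → Colouring n k → Set
P5OrStar c = MonoP5 c ⊎ ∃[ v ] ∃[ q ] MonoStar c v q

module FiveOrMore {p k} {c : Colouring (5 + p) k} (gallai : Gallai c) where

  open Triangles {c = c} gallai
  open Paths {c = c}

  private
    C : Fin (5 + p) → Fin (5 + p) → Fin k
    C = col c
    C-sym : ∀ x y → C x y ≡ C y x
    C-sym = Colouring.sym c

  fresh4 : ∀ a b d e → ∃[ w ] (w ≢ a × w ≢ b × w ≢ d × w ≢ e)
  fresh4 a b d e with fresh (a V.∷ b V.∷ d V.∷ e V.∷ V.[]) (m≤m+n 5 p)
  ... | w , w∉ = w , w∉ (# 0) , w∉ (# 1) , w∉ (# 2) , w∉ (# 3)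

  offLeg : ∀ {x v w q} → x ≢ v → MonoStarOff c x v q → C x v ≢ q →
    w ≢ x → w ≢ v → C x w ≡ q ⊎ C x w ≡ C x v
  offLeg x≢v star xv≢q w≢x w≢v = legColour x≢v (≢-sym w≢x) (≢-sym w≢v) (star _ w≢x w≢v) refl xv≢q

  -- Triangles x w₀ w force C w₀ w ∈ {q, C x v} for the remaining w; a q-edge w₀ w yields the
  -- q-path x w₀ w v w′, and otherwise w₂ w₀ w₁ x v is a path of colour C x v.
  uniqueLeg⇒P5 : ∀ {x v w₀ q} → x ≢ v → w₀ ≢ x → w₀ ≢ v → MonoStarOff c x v q →
    C x v ≢ q → C x w₀ ≡ q → (∀ w → w ≢ x → w ≢ v → w ≢ w₀ → C x w ≡ C x v) → MonoP5 c
  uniqueLeg⇒P5 {x} {v} {w₀} {q} x≢v w₀≢x w₀≢v star xv≢q xw₀ others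
    with any? (λ w → w ≢? x ×-dec w ≢? v ×-dec w ≢? w₀ ×-dec (C w₀ w ≟ q))
  ... | yes (w , w≢x , w≢v , w≢w₀ , w₀w) with fresh4 x v w₀ w
  ...   | w′ , w′≢x , w′≢v , w′≢w₀ , w′≢w =
    q , path5 (≢-sym w₀≢x) (≢-sym w≢x) x≢v (≢-sym w′≢x) (≢-sym w≢w₀) w₀≢v (≢-sym w′≢w₀)
              w≢v (≢-sym w′≢w) (≢-sym w′≢v)
              xw₀ w₀w (trans (C-sym w v) (star w w≢x w≢v)) (star w′ w′≢x w′≢v)
  uniqueLeg⇒P5 {x} {v} {w₀} {q} x≢v w₀≢x w₀≢v star xv≢q xw₀ others
    | no none with fresh4 x v w₀ w₀
  ... | w₁ , w₁≢x , w₁≢v , w₁≢w₀ , _ with fresh4 x v w₀ w₁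
  ...   | w₂ , w₂≢x , w₂≢v , w₂≢w₀ , w₂≢w₁ =
    C x v , path5 w₂≢w₀ w₂≢w₁ w₂≢x w₂≢v (≢-sym w₁≢w₀) w₀≢x w₀≢v w₁≢x w₁≢v x≢v
              (trans (C-sym w₂ w₀) (w₀-leg w₂≢x w₂≢v w₂≢w₀)) (w₀-leg w₁≢x w₁≢v w₁≢w₀)
              (trans (C-sym w₁ x) (others w₁ w₁≢x w₁≢v w₁≢w₀)) refl
    where
    w₀-leg : ∀ {w} → w ≢ x → w ≢ v → w ≢ w₀ → C w₀ w ≡ C x v
    w₀-leg {w} w≢x w≢v w≢w₀
      with legColour w₀≢x (≢-sym w≢w₀) (≢-sym w≢x) (others w w≢x w≢v w≢w₀)
                     (trans (C-sym w₀ x) xw₀) (xv≢q ∘ ≡-sym)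
    ... | inj₁ w₀w = w₀w
    ... | inj₂ w₀w = contradiction (w , w≢x , w≢v , w≢w₀ , w₀w) none

  starOff⇒P5OrStar : ∀ {x v q} → x ≢ v → MonoStarOff c x v q → P5OrStar c
  starOff⇒P5OrStar {x} {v} {q} x≢v star with C x v ≟ q
  ... | yes xv = inj₂ (v , q , vStar)
    where
    vStar : MonoStar c v q
    vStar w w≢v with w ≟ x
    ... | yes refl = trans (C-sym v w) xv
    ... | no w≢x = star w w≢x w≢v
  ... | no xv≢q with any? (λ w → w ≢? x ×-dec w ≢? v ×-dec (C x w ≟ q))
  ...   | no none = inj₂ (x , C x v , xStar)
    where
    xStar : MonoStar c x (C x v)
    xStar w w≢x with w ≟ v
    ... | yes refl = refl
    ... | no w≢v with offLeg x≢v star xv≢q w≢x w≢v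
    ...   | inj₁ xw = contradiction (w , w≢x , w≢v , xw) none
    ...   | inj₂ xw = xw
  ...   | yes (w₀ , w₀≢x , w₀≢v , xw₀)
    with any? (λ w → w ≢? x ×-dec w ≢? v ×-dec w ≢? w₀ ×-dec (C x w ≟ q))
  ...     | yes (w₁ , w₁≢x , w₁≢v , w₁≢w₀ , xw₁) with fresh4 x v w₀ w₁
  ...       | w₂ , w₂≢x , w₂≢v , w₂≢w₀ , w₂≢w₁ =
    inj₁ (q , path5 w₀≢x (≢-sym w₁≢w₀) w₀≢v (≢-sym w₂≢w₀) (≢-sym w₁≢x) x≢v (≢-sym w₂≢x)
                    w₁≢v (≢-sym w₂≢w₁) (≢-sym w₂≢v)
                    (trans (C-sym w₀ x) xw₀) xw₁ (trans (C-sym w₁ v) (star w₁ w₁≢x w₁≢v))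
                    (star w₂ w₂≢x w₂≢v))
  starOff⇒P5OrStar {x} {v} {q} x≢v star | no xv≢q | yes (w₀ , w₀≢x , w₀≢v , xw₀) | no noOther =
    inj₁ (uniqueLeg⇒P5 x≢v w₀≢x w₀≢v star xv≢q xw₀ others)
    where
    others : ∀ w → w ≢ x → w ≢ v → w ≢ w₀ → C x w ≡ C x v
    others w w≢x w≢v w≢w₀ with offLeg x≢v star xv≢q w≢x w≢v
    ... | inj₁ xw = contradiction (w , w≢x , w≢v , w≢w₀ , xw) noOther
    ... | inj₂ xw = xw

  coveringP4⇒P5OrStar : ∀ {x a b d e q} →
    x ≢ a → x ≢ b → x ≢ d → x ≢ e → a ≢ b → a ≢ d → a ≢ e → b ≢ d → b ≢ e → d ≢ e →
    Covers (x ∷ a ∷ b ∷ d ∷ e ∷ []) → C a b ≡ q → C b d ≡ q → C d e ≡ q → P5OrStar c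
  coveringP4⇒P5OrStar {x} {a} {b} {d} {e} {q}
    x≢a x≢b x≢d x≢e a≢b a≢d a≢e b≢d b≢e d≢e cover ab bd de
    with C x a ≟ q | C x e ≟ q | C x b ≟ q | C x d ≟ q
  ... | yes xa | _ | _ | _ =
    inj₁ (q , path5 x≢a x≢b x≢d x≢e a≢b a≢d a≢e b≢d b≢e d≢e xa ab bd de)
  ... | no _ | yes xe | _ | _ =
    inj₁ (q , path5 a≢b a≢d a≢e (≢-sym x≢a) b≢d b≢e (≢-sym x≢b) d≢e (≢-sym x≢d) (≢-sym x≢e)
                    ab bd de (trans (C-sym e x) xe))
  ... | no _ | no _ | yes xb | _ = starOff⇒P5OrStar (≢-sym b≢e) (covered _ cover
    ( (λ _ _ → trans (C-sym b x) xb)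
    ∷ (λ _ _ → trans (C-sym b a) ab)
    ∷ (λ _ b≢b → contradiction refl b≢b)
    ∷ (λ _ _ → bd)
    ∷ (λ e≢e _ → contradiction refl e≢e)
    ∷ []))
  ... | no _ | no _ | no _ | yes xd = starOff⇒P5OrStar a≢d (covered _ cover
    ( (λ _ _ → trans (C-sym d x) xd)
    ∷ (λ a≢a _ → contradiction refl a≢a)
    ∷ (λ _ _ → trans (C-sym d b) bd)
    ∷ (λ _ d≢d → contradiction refl d≢d)
    ∷ (λ _ _ → de)
    ∷ []))
  ... | no xa≢q | no xe≢q | no xb≢q | no xd≢q = inj₂ (x , C x a , covered _ cover
    ( (λ x≢x → contradiction refl x≢x)
    ∷ (λ _ → refl)
    ∷ (λ _ → ≡-sym xa≡xb)
    ∷ (λ _ → ≡-sym (trans xa≡xb xb≡xd))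
    ∷ (λ _ → ≡-sym (trans xa≡xb (trans xb≡xd xd≡xe)))
    ∷ []))
    where
    xa≡xb = equalLegs x≢a x≢b a≢b ab xa≢q xb≢q
    xb≡xd = equalLegs x≢b x≢d b≢d bd xb≢q xd≢q
    xd≡xe = equalLegs x≢d x≢e d≢e de xd≢q xe≢q

  corner⇒P5OrStar : ∀ {x y a b d} →
    x ≢ y → x ≢ a → x ≢ b → x ≢ d → y ≢ a → y ≢ b → y ≢ d → a ≢ b → a ≢ d → b ≢ d →
    Covers (x ∷ y ∷ a ∷ b ∷ d ∷ []) → C b a ≡ C b d → P5OrStar c
  corner⇒P5OrStar {x} {y} {a} {b} {d} x≢y x≢a x≢b x≢d y≢a y≢b y≢d a≢b a≢d b≢d cover ba≡bd
    with C y a ≟ C b a | C y d ≟ C b a | C b y ≟ C b a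
  ... | yes ya | _ | _ =
    coveringP4⇒P5OrStar x≢y x≢a x≢b x≢d y≢a y≢b y≢d a≢b a≢d b≢d cover
      ya (C-sym a b) (≡-sym ba≡bd)
  ... | no _ | yes yd | _ =
    coveringP4⇒P5OrStar x≢y x≢d x≢b x≢a y≢d y≢b y≢a (≢-sym b≢d) (≢-sym a≢d) (≢-sym a≢b)
      (covered _ cover
        ( here refl
        ∷ there (here refl)
        ∷ there (there (there (there (here refl))))
        ∷ there (there (there (here refl)))
        ∷ there (there (here refl))
        ∷ []))
      yd (trans (C-sym d b) (≡-sym ba≡bd)) refl
  ... | no _ | no _ | yes by = starOff⇒P5OrStar x≢b (covered _ cover
    ( (λ x≢x _ → contradiction refl x≢x)
    ∷ (λ _ _ → by)
    ∷ (λ _ _ → refl)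
    ∷ (λ _ b≢b → contradiction refl b≢b)
    ∷ (λ _ _ → ≡-sym ba≡bd)
    ∷ []))
  ... | no ya≢q | no yd≢q | no by≢q = starOff⇒P5OrStar x≢y (covered _ cover
    ( (λ x≢x _ → contradiction refl x≢x)
    ∷ (λ _ y≢y → contradiction refl y≢y)
    ∷ (λ _ _ → refl)
    ∷ (λ _ _ → ≡-sym ya≡yb)
    ∷ (λ _ _ → ≡-sym (trans ya≡yb yb≡yd))
    ∷ []))
    where
    yb≢q : C y b ≢ C b a
    yb≢q = by≢q ∘ trans (C-sym b y)
    ya≡yb = equalLegs y≢a y≢b a≢b (C-sym a b) ya≢q yb≢q
    yb≡yd = equalLegs y≢b y≢d b≢d (≡-sym ba≡bd) yb≢q yd≢q

gallai⇒P5OrStar-K₅ : ∀ {k} {c : Colouring 5 k} → Gallai c → P5OrStar c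
gallai⇒P5OrStar-K₅ {c = c} gallai = fromCorner (monoCorner {# 1} {# 2} {# 3} (λ ()) (λ ()) (λ ()))
  where
  open Triangles {c = c} gallai
  open FiveOrMore {c = c} gallai
  fromCorner : col c (# 2) (# 1) ≡ col c (# 2) (# 3) ⊎ col c (# 1) (# 2) ≡ col c (# 1) (# 3)
             ⊎ col c (# 3) (# 1) ≡ col c (# 3) (# 2) → P5OrStar c
  fromCorner (inj₁ corner) = corner⇒P5OrStar {# 0} {# 4} {# 1} {# 2} {# 3}
    (λ ()) (λ ()) (λ ()) (λ ()) (λ ()) (λ ()) (λ ()) (λ ()) (λ ()) (λ ())
    (from-yes (covers? {5} (# 0 ∷ # 4 ∷ # 1 ∷ # 2 ∷ # 3 ∷ []))) corner
  fromCorner (inj₂ (inj₁ corner)) = corner⇒P5OrStar {# 0} {# 4} {# 2} {# 1} {# 3}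
    (λ ()) (λ ()) (λ ()) (λ ()) (λ ()) (λ ()) (λ ()) (λ ()) (λ ()) (λ ())
    (from-yes (covers? {5} (# 0 ∷ # 4 ∷ # 2 ∷ # 1 ∷ # 3 ∷ []))) corner
  fromCorner (inj₂ (inj₂ corner)) = corner⇒P5OrStar {# 0} {# 4} {# 1} {# 3} {# 2}
    (λ ()) (λ ()) (λ ()) (λ ()) (λ ()) (λ ()) (λ ()) (λ ()) (λ ()) (λ ())
    (from-yes (covers? {5} (# 0 ∷ # 4 ∷ # 1 ∷ # 3 ∷ # 2 ∷ []))) corner

gallai⇒P5OrStar : ∀ p {k} {c : Colouring (5 + p) k} → Gallai c → P5OrStar c
gallai⇒P5OrStar zero {c = c} = gallai⇒P5OrStar-K₅ {c = c}
gallai⇒P5OrStar (suc p) {c = c} gallai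
  with gallai⇒P5OrStar p {c = restrict fsuc c} (restrict-gallai suc-injective {c = c} gallai)
... | inj₁ (i , path) = inj₁ (i , restrict-monoPath suc-injective {c = c} path)
... | inj₂ (v , q , star) =
  FiveOrMore.starOff⇒P5OrStar {c = c} gallai {fzero} {fsuc v} (λ ()) starOff
  where
  starOff : MonoStarOff c fzero (fsuc v) q
  starOff fzero    0≢0 _   = contradiction refl 0≢0
  starOff (fsuc w) _   w≢v = star w (w≢v ∘ cong fsuc)

P5InOrP3Outside : ∀ {n k} → Colouring n k → List (Fin k) → Set
P5InOrP3Outside c L = (∃[ i ] (i ∈ L × MonoPath c 4 i)) ⊎ (∃[ i ] (i ∉ L × MonoPath c 2 i))

P5⇒P5InOrP3Outside : ∀ {n k} {c : Colouring n k} {i} L → MonoPath c 4 i → P5InOrP3Outside c L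
P5⇒P5InOrP3Outside {c = c} {i = i} L path with Any.any? (i ≟_) L
... | yes i∈L = inj₁ (i , i∈L , path)
... | no i∉L = inj₂ (i , i∉L , MonoPath-init (MonoPath-init path))
  where open Paths {c = c}

dropColour : ∀ {k} → Fin k → List (Fin k) → List (Fin k)
dropColour q = filter (_≢? q)

length-dropColour : ∀ {k} {q : Fin k} {L} → q ∈ L → length (dropColour q L) < length L
length-dropColour {q = q} {L} q∈L =
  filter-notAll (_≢? q) L (Any.map (λ q≡j j≢q → j≢q (≡-sym q≡j)) q∈L)

module StarDeletion {p k} {c : Colouring (5 + p) k} {v q} (star : MonoStar c v q) where

  open Paths {c = c}

  private
    ι : Fin (4 + p) → Fin (5 + p)
    ι = punchIn v
    ι-injective : Injective _≡_ _≡_ ι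
    ι-injective = punchIn-injective v _ _
    v∉ι : ∀ w → ι w ≢ v
    v∉ι = punchInᵢ≢i v

  star-P3 : MonoPath c 2 q
  star-P3 = path3 (v∉ι fzero) ((λ ()) ∘ ι-injective) (≢-sym (v∉ι (fsuc fzero)))
                  (trans (Colouring.sym c _ v) (star _ (v∉ι fzero))) (star _ (v∉ι (fsuc fzero)))

  P3⇒P5 : MonoPath (restrict ι c) 2 q → MonoPath c 4 q
  P3⇒P5 path@(u , _) with fresh (v V.∷ ι ∘ u) (m≤m+n 5 p)
  ... | w , w∉ = MonoPath-cons w throughV w∉ (trans (Colouring.sym c w v) (star w (w∉ fzero)))
    where
    throughV : MonoPath c 3 q
    throughV = MonoPath-cons v (restrict-monoPath ι-injective {c = c} path)
                 (λ j → ≢-sym (v∉ι (u j))) (star _ (v∉ι (u fzero)))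

  lift-P5InOrP3Outside : ∀ {L} → q ∈ L →
    P5InOrP3Outside (restrict ι c) (dropColour q L) → P5InOrP3Outside c L
  lift-P5InOrP3Outside _ (inj₁ (i , i∈L′ , path)) =
    inj₁ (i , proj₁ (∈-filter⁻ (_≢? q) i∈L′) , restrict-monoPath ι-injective {c = c} path)
  lift-P5InOrP3Outside q∈L (inj₂ (i , i∉L′ , path)) with i ≟ q
  ... | yes refl = inj₁ (q , q∈L , P3⇒P5 path)
  ... | no i≢q = inj₂ (i , (λ i∈L → i∉L′ (∈-filter⁺ (_≢? q) i∈L i≢q)) ,
                       restrict-monoPath ι-injective {c = c} path)

gallai⇒P5InOrP3Outside : ∀ {k} p (L : List (Fin k)) {c : Colouring (4 + p) k} →
  length L ≤ p → Gallai c → P5InOrP3Outside c L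
gallai⇒P5InOrP3Outside p [] {c} _ gallai =
  fromCorner (monoCorner {# 0} {# 1} {# 2} (λ ()) (λ ()) (λ ()))
  where
  open Triangles {c = c} gallai
  open Paths {c = c}
  fromCorner : col c (# 1) (# 0) ≡ col c (# 1) (# 2) ⊎ col c (# 0) (# 1) ≡ col c (# 0) (# 2)
             ⊎ col c (# 2) (# 0) ≡ col c (# 2) (# 1) → P5InOrP3Outside c []
  fromCorner (inj₁ e) =
    inj₂ (_ , (λ ()) , path3 (λ ()) (λ ()) (λ ()) (trans (Colouring.sym c (# 0) (# 1)) e) refl)
  fromCorner (inj₂ (inj₁ e)) =
    inj₂ (_ , (λ ()) , path3 (λ ()) (λ ()) (λ ()) (trans (Colouring.sym c (# 1) (# 0)) e) refl)
  fromCorner (inj₂ (inj₂ e)) =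
    inj₂ (_ , (λ ()) , path3 (λ ()) (λ ()) (λ ()) (trans (Colouring.sym c (# 0) (# 2)) e) refl)
gallai⇒P5InOrP3Outside zero (_ ∷ _) ()
gallai⇒P5InOrP3Outside (suc p) L@(_ ∷ L₀) {c} (s≤s |L₀|≤p) gallai
  with gallai⇒P5OrStar p {c = c} gallai
... | inj₁ (i , path) = P5⇒P5InOrP3Outside {c = c} L path
... | inj₂ (v , q , star) with Any.any? (q ≟_) L
...   | no q∉L = inj₂ (q , q∉L , StarDeletion.star-P3 {c = c} star)
...   | yes q∈L = StarDeletion.lift-P5InOrP3Outside {c = c} star q∈L
    (gallai⇒P5InOrP3Outside p (dropColour q L) {restrict (punchIn v) c}
      (≤-trans (s≤s⁻¹ (length-dropColour q∈L)) |L₀|≤p)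
      (restrict-gallai (punchIn-injective v _ _) {c = c} gallai))

module _ {k t : ℕ} (t≤k : t ≤ k) where

  coloursBelow : List (Fin k)
  coloursBelow = tabulate (λ (j : Fin t) → inject≤ j t≤k)

  ∈-coloursBelow⇒< : ∀ {i} → i ∈ coloursBelow → toℕ i < t
  ∈-coloursBelow⇒< i∈ with ∈-tabulate⁻ i∈
  ... | j , refl = subst (_< t) (≡-sym (toℕ-inject≤ j t≤k)) (toℕ<n j)

  <⇒∈-coloursBelow : ∀ {i} → toℕ i < t → i ∈ coloursBelow
  <⇒∈-coloursBelow {i} i<t = subst (_∈ coloursBelow) (≡-sym i≡j) (∈-tabulate⁺ (fromℕ< i<t))
    where
    i≡j : i ≡ inject≤ (fromℕ< i<t) t≤k
    i≡j = toℕ-injective (≡-sym (trans (toℕ-inject≤ (fromℕ< i<t) t≤k) (toℕ-fromℕ< i<t)))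

lemma1 : (k t : ℕ) → 2 ≤ k → t ≤ k → (n : ℕ) → n ≥ t + 4 →
    (c : Colouring n k) → ¬ RainbowTriangle c →
    (∃[ i ] (toℕ i < t × MonoPath c 4 i)) ⊎ (∃[ i ] (t ≤ toℕ i × MonoPath c 2 i))
lemma1 k t _ t≤k n n≥t+4 c gallai =
  Sum.map (map₂ (map₁ (∈-coloursBelow⇒< t≤k)))
          (map₂ (map₁ (λ i∉ → ≮⇒≥ (i∉ ∘ <⇒∈-coloursBelow t≤k))))
          (paths (subst (_≤ n) (+-comm t 4) n≥t+4) c gallai)
  where
  paths : ∀ {m} → 4 + t ≤ m → (c : Colouring m k) → Gallai c → P5InOrP3Outside c (coloursBelow t≤k)
  paths (s≤s (s≤s (s≤s (s≤s t≤p)))) c =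
    gallai⇒P5InOrP3Outside _ (coloursBelow t≤k) {c}
      (subst (_≤ _) (≡-sym (length-tabulate (λ j → inject≤ j t≤k))) t≤p)
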